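{- Let $f:[n]\times[n]\times[N]\to\{0,1\}$ be a weak sub-permutation, and let $S$ be a symmetric cylinder intersection with respect to $f$. Let $H=([n],F)$ be the graph with $$F=\{(x,y):\ \exists z\in[N] \text{ such that } (x,y,z)\in S\}.$$ Then the edges of $F$ can be partitioned into $N$ induced matchings of $H$.
   Context: A line in $[n]\times[n]\times[N]$ is a set obtained by fixing two coordinates and letting the third range over all its values. A weak sub-permutation is $f:[n]\times[n]\times[N]\to\{0,1\}$ with $N\ge n$ such that every line contains at most one entry with value $1$. Number-On-the-Forehead (one-sided) model with 3 players: on input $(x,y,z)$ player 1 sees $(y,z)$, player 2 sees $(x,z)$, player 3 sees $(x,y)$. Following an agreed protocol, players take turns writing bits on a common board; each message depends on what the writer sees and, except for player 3, on the board so far; player 3's message depends only on $(x,y)$. The value of $f$ is determined by the final board. The transcript $\mathcal{T}(x,y,z)$ is the full board content. A cylinder intersection with respect to $f$ is a set $\{(x,y,z):\ \mathcal{T}(x,y,z)=T,\ f(x,y,z)=1\}$ for some protocol for $f$ and some transcript $T$. $S$ is symmetric if $(x,y,z)\in S$ iff $(y,x,z)\in S$. Self loops (pairs $(x,x)$) are allowed in $F$, and a collection of self loops is regarded as a matching. A matching $M$ in $H$ is induced if the subgraph of $H$ induced on the vertices covered by $M$ has exactly the edges of $M$. -}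

module Defs where

open import Data.Nat using (ℕ; _≥_)
open import Data.Fin using (Fin)
open import Data.Bool using (Bool; true; false; if_then_else_)
open import Data.List using (List; []; _∷_)
open import Data.Product using (Σ; ∃; ∃-syntax; _×_; _,_)
open import Relation.Binary.PropositionalEquality using (_≡_)
open import Function.Bundles using (_⇔_)

record WeakSubPerm (n N : ℕ) (f : Fin n → Fin n → Fin N → Bool) : Set where
  field
    N≥n     : N ≥ n
    line-z  : ∀ x y z z′ → f x y z ≡ true → f x y z′ ≡ true → z ≡ z′
    line-y  : ∀ x y y′ z → f x y z ≡ true → f x y′ z ≡ true → y ≡ y′
    line-x  : ∀ x x′ y z → f x y z ≡ true → f x′ y z ≡ true → x ≡ x′

-- One-sided 3-party NOF protocols.
-- Player 3 (who sees (x , y)) writes a message depending only on (x , y);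
-- afterwards players 1 and 2 take turns writing bits.  The position in the
-- tree encodes the board so far, so the bits of players 1 and 2 depend on
-- what they see and on the board.

data Tree (n N : ℕ) : Set where
  done  : Tree n N
  -- player 1 sees (y , z)
  bit₁  : (Fin n → Fin N → Bool) → (Tree n N) → (Tree n N) → Tree n N
  -- player 2 sees (x , z)
  bit₂  : (Fin n → Fin N → Bool) → (Tree n N) → (Tree n N) → Tree n N

run : ∀ {n N} → Tree n N → Fin n → Fin n → Fin N → List Bool
run done         x y z = []
run (bit₁ g t e) x y z = g y z ∷ (if g y z then run t x y z else run e x y z)
run (bit₂ g t e) x y z = g x z ∷ (if g x z then run t x y z else run e x y z)

record Protocol (n N : ℕ) : Set where
  field
    msg₃ : Fin n → Fin n → List Bool
    rest : List Bool → Tree n N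

Transcript : Set
Transcript = List Bool × List Bool

transcript : ∀ {n N} → Protocol n N → Fin n → Fin n → Fin N → Transcript
transcript P x y z =
  Protocol.msg₃ P x y , run (Protocol.rest P (Protocol.msg₃ P x y)) x y z

ProtocolFor : ∀ {n N} → (Fin n → Fin n → Fin N → Bool) → Protocol n N → Set
ProtocolFor f P = ∀ x y z x′ y′ z′ →
  transcript P x y z ≡ transcript P x′ y′ z′ → f x y z ≡ f x′ y′ z′

CylinderIntersection : ∀ {n N} → (Fin n → Fin n → Fin N → Bool) →
                       (Fin n → Fin n → Fin N → Set) → Set
CylinderIntersection {n} {N} f S =
  Σ (Protocol n N) λ P → ProtocolFor f P × Σ Transcript λ T →
    ∀ x y z → S x y z ⇔ (transcript P x y z ≡ T × f x y z ≡ true)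

Symmetric : ∀ {n N} → (Fin n → Fin n → Fin N → Set) → Set
Symmetric S = ∀ x y z → S x y z ⇔ S y x z

-- Graphs on [n] given by an edge relation on ordered pairs (symmetric
-- when undirected); self loops (x , x) allowed.

EdgesOf : ∀ {n N} → (Fin n → Fin n → Fin N → Set) → Fin n → Fin n → Set
EdgesOf {N = N} S x y = ∃[ z ] S x y z

-- M is a matching: undirected (symmetric), and each vertex lies on at most
-- one edge of M (a self loop (x , x) covers only x)
IsMatching : ∀ {n} → (Fin n → Fin n → Set) → Set
IsMatching M = (∀ x y → M x y → M y x) × (∀ x y y′ → M x y → M x y′ → y ≡ y′)

Covered : ∀ {n} → (Fin n → Fin n → Set) → Fin n → Set
Covered M u = ∃[ w ] M u w

IsInducedMatching : ∀ {n} → (Fin n → Fin n → Set) → (Fin n → Fin n → Set) → Set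
IsInducedMatching E M =
  IsMatching M × (∀ x y → M x y → E x y) ×
  (∀ u v → Covered M u → Covered M v → E u v → M u v)

PartitionIntoInducedMatchings : ∀ {n} (N : ℕ) → (Fin n → Fin n → Set) → Set₁
PartitionIntoInducedMatchings {n} N E =
  Σ (Fin N → Fin n → Fin n → Set) λ M →
    (∀ i → IsInducedMatching E (M i)) ×
    (∀ x y → E x y → ∃[ i ] M i x y) ×
    (∀ i j x y → M i x y → M j x y → i ≡ j)

module Submission where

-- Slice S into its layers  S_z = {(x , y) : (x , y , z) ∈ S}
-- and take S_z as the z-th matching.  Every edge lies in some layer, and in
-- no two layers because each (x , y)-line of f has at most one 1.  Each
-- layer is a matching: it is symmetric because S is, and functional because
-- each (x , z)-line of f has at most one 1.  The real content is that a
-- layer is INDUCED, which is the rectangle property of cylinder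
-- intersections: once z is fixed, the bits of players 1 and 2 depend on x
-- and on y separately, so two inputs (x₁ , y₁ , z) and (x₂ , y₂ , z) with the
-- same board force the same board on (x₁ , y₂ , z) provided player 3 (who
-- sees (x₁ , y₂)) writes the same message; an edge (x₁ , y₂) in any layer
-- guarantees exactly that.

open import Defs
open import Data.Nat using (ℕ)
open import Data.Fin using (Fin)
open import Data.Bool using (Bool; true; false)
open import Data.List using (_∷_)
open import Data.List.Properties using (∷-injectiveʳ)
open import Data.Product using (∃-syntax; _×_; _,_; proj₁; proj₂)
open import Relation.Binary.PropositionalEquality
  using (_≡_; refl; cong; sym; trans)
open import Function.Bundles using (Equivalence)

open Equivalence using (to; from)

-- Player 1 reads y and agrees with the run on (x₂ , y₂);
-- player 2 reads x and agrees with the run on (x₁ , y₁).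
run-rectangle : ∀ {n N} (t : Tree n N) {x₁ y₁ x₂ y₂ : Fin n} {z : Fin N} →
  run t x₁ y₁ z ≡ run t x₂ y₂ z → run t x₁ y₂ z ≡ run t x₁ y₁ z
run-rectangle done _ = refl
run-rectangle (bit₁ g t e) {y₁ = y₁} {y₂ = y₂} {z = z} same
  with g y₁ z | g y₂ z | same
... | true  | true  | same′ = cong (true ∷_) (run-rectangle t (∷-injectiveʳ same′))
... | false | false | same′ = cong (false ∷_) (run-rectangle e (∷-injectiveʳ same′))
... | true  | false | ()
... | false | true  | ()
run-rectangle (bit₂ g t e) {x₁ = x₁} {x₂ = x₂} {z = z} same
  with g x₁ z | g x₂ z | same
... | true  | true  | same′ = cong (true ∷_) (run-rectangle t (∷-injectiveʳ same′))
... | false | false | same′ = cong (false ∷_) (run-rectangle e (∷-injectiveʳ same′))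
... | true  | false | ()
... | false | true  | ()

module TranscriptProperties {n N : ℕ} (P : Protocol n N) where
  open Protocol P

  transcript-split : ∀ {x y z m r} → transcript P x y z ≡ (m , r) →
    msg₃ x y ≡ m × run (rest m) x y z ≡ r
  transcript-split refl = refl , refl

  transcript-join : ∀ {x y z m r} →
    msg₃ x y ≡ m → run (rest m) x y z ≡ r → transcript P x y z ≡ (m , r)
  transcript-join refl refl = refl

  -- The rectangle property for full transcripts: player 3's message on the
  -- mixed pair must be checked separately, since player 3 sees (x₁ , y₂).
  transcript-rectangle : ∀ {x₁ y₁ x₂ y₂ z m r} →
    transcript P x₁ y₁ z ≡ (m , r) → transcript P x₂ y₂ z ≡ (m , r) →
    msg₃ x₁ y₂ ≡ m → transcript P x₁ y₂ z ≡ (m , r)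
  transcript-rectangle {m = m} board₁ board₂ msg-mixed
    with transcript-split board₁ | transcript-split board₂
  ... | _ , bits₁ | _ , bits₂ =
    transcript-join msg-mixed
      (trans (run-rectangle (rest m) (trans bits₁ (sym bits₂))) bits₁)

module CylinderProperties {n N : ℕ} {f : Fin n → Fin n → Fin N → Bool}
  {S : Fin n → Fin n → Fin N → Set} (cyl : CylinderIntersection f S) where

  private
    P = proj₁ cyl
    isProtocolFor = proj₁ (proj₂ cyl)
    board = proj₁ (proj₂ (proj₂ cyl))
    membership = proj₂ (proj₂ (proj₂ cyl))
  open TranscriptProperties P

  cylinder⊆support : ∀ {x y z} → S x y z → f x y z ≡ true
  cylinder⊆support {x} {y} {z} s = proj₂ (to (membership x y z) s)

  -- The membership in layer z′ only serves to fix
  -- player 3's message on (x₁ , y₂).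
  cylinder-rectangle : ∀ {x₁ y₁ x₂ y₂ z z′} →
    S x₁ y₁ z → S x₂ y₂ z → S x₁ y₂ z′ → S x₁ y₂ z
  cylinder-rectangle {x₁} {y₁} {x₂} {y₂} {z} {z′} s₁ s₂ s′ =
    from (membership x₁ y₂ z) (mixed-board , mixed-value)
    where
    mixed-board : transcript P x₁ y₂ z ≡ board
    mixed-board =
      transcript-rectangle (proj₁ (to (membership x₁ y₁ z) s₁))
        (proj₁ (to (membership x₂ y₂ z) s₂))
        (proj₁ (transcript-split (proj₁ (to (membership x₁ y₂ z′) s′))))
    -- f is determined by the board, which (x₁ , y₂ , z) shares with (x₁ , y₁ , z)
    mixed-value : f x₁ y₂ z ≡ true
    mixed-value =
      trans (isProtocolFor x₁ y₂ z x₁ y₁ z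
               (trans mixed-board (sym (proj₁ (to (membership x₁ y₁ z) s₁)))))
            (cylinder⊆support s₁)

Layer : ∀ {n N : ℕ} → (Fin n → Fin n → Fin N → Set) → Fin N → Fin n → Fin n → Set
Layer S z x y = S x y z

module SupportProperties {n N : ℕ} {f : Fin n → Fin n → Fin N → Bool}
  (wsp : WeakSubPerm n N f) {S : Fin n → Fin n → Fin N → Set}
  (S⊆support : ∀ {x y z} → S x y z → f x y z ≡ true) where
  open WeakSubPerm wsp

  layer-functional : ∀ z x y y′ → Layer S z x y → Layer S z x y′ → y ≡ y′
  layer-functional z x y y′ s s′ = line-y x y y′ z (S⊆support s) (S⊆support s′)

  layers-disjoint : ∀ z z′ x y → Layer S z x y → Layer S z′ x y → z ≡ z′
  layers-disjoint z z′ x y s s′ = line-z x y z z′ (S⊆support s) (S⊆support s′)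

-- In a symmetric cylinder intersection every layer is an induced matching
-- of the graph H = ([n] , EdgesOf S): the induced condition is exactly the
-- rectangle property, after turning the edge covering v around.
layer-induced : ∀ {n N} {f : Fin n → Fin n → Fin N → Bool} →
  WeakSubPerm n N f → {S : Fin n → Fin n → Fin N → Set} →
  CylinderIntersection f S → Symmetric S →
  ∀ z → IsInducedMatching (EdgesOf S) (Layer S z)
layer-induced wsp {S} cyl symmetric z =
  (layer-symmetric , layer-functional z) , layer⊆edges , induced
  where
  open CylinderProperties cyl
  open SupportProperties wsp cylinder⊆support

  layer-symmetric : ∀ x y → Layer S z x y → Layer S z y x
  layer-symmetric x y = to (symmetric x y z)

  layer⊆edges : ∀ x y → Layer S z x y → EdgesOf S x y
  layer⊆edges x y s = z , s

  induced : ∀ u v → Covered (Layer S z) u → Covered (Layer S z) v →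
    EdgesOf S u v → Layer S z u v
  induced u v (w , uw) (w′ , vw′) (z′ , uv) =
    cylinder-rectangle uw (layer-symmetric v w′ vw′) uv

lemma4p4 : (n N : ℕ) (f : Fin n → Fin n → Fin N → Bool) →
    WeakSubPerm n N f →
    (S : Fin n → Fin n → Fin N → Set) →
    CylinderIntersection f S → Symmetric S →
    PartitionIntoInducedMatchings N (EdgesOf S)
lemma4p4 _ _ _ wsp S cyl symmetric =
  Layer S , layer-induced wsp cyl symmetric , edge-in-layer , layers-disjoint
  where
  open SupportProperties wsp (CylinderProperties.cylinder⊆support cyl)

  edge-in-layer : ∀ x y → EdgesOf S x y → ∃[ z ] Layer S z x y
  edge-in-layer x y (z , s) = z , s
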